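{- Let $X=\{x_1,\dots,x_9\}$ be a set of nine pairwise distinct positive integers with $\sum_{i=1}^9 1/x_i=1$, at least one of which is even, and such that the set of primes dividing $x_1x_2\cdots x_9$ consists of exactly two primes (namely $2$ and one odd prime). Let $\alpha_2=\max_i v_2(x_i)$. (i) If $2\notin X$ and $\alpha_2=1$, no such $X$ exists. (ii) If $2\in X$ and $\alpha_2=1$, then $X=\{2,3,3^2,3^3,3^4,3^5,3^6,3^7,2\cdot 3^7\}$, and this set is indeed a solution.
   Context: $v_2$ denotes the $2$-adic valuation. -}

module Defs where

open import Data.Nat using (ℕ; zero; suc; _*_; _^_; _⊔_)
open import Data.Nat.Divisibility using (_∣_)
open import Data.Nat.Primality using (Prime)
open import Data.Nat.DivMod using (_/_; _%_)
open import Data.Fin using (Fin)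
open import Data.Vec using (Vec; tabulate; foldr; _∷_; [])
import Data.Vec as V
open import Data.Integer using (+_)
open import Data.Rational using (ℚ) renaming (_/_ to _÷_; _+_ to _+ℚ_; 0ℚ to 0q; 1ℚ to 1q)
open import Data.Product using (_×_; ∃; ∃-syntax)
open import Data.Sum using (_⊎_)
open import Function using (_⇔_)
open import Function.Definitions using (Injective)
open import Relation.Binary.PropositionalEquality using (_≡_; _≢_)

-- reciprocal 1/n as a rational (1/0 := 0; only used for positive n)
recip : ℕ → ℚ
recip zero = 0q
recip (suc n) = (+ 1) ÷ suc n

sumRecip : (Fin 9 → ℕ) → ℚ
sumRecip x = foldr (λ _ → ℚ) _+ℚ_ 0q (tabulate (λ i → recip (x i)))

prod : (Fin 9 → ℕ) → ℕ
prod x = foldr (λ _ → ℕ) _*_ 1 (tabulate x)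

-- 2-adic valuation (with fuel = n, which suffices); v₂ 0 := 0
v₂go : ℕ → ℕ → ℕ
v₂go zero n = 0
v₂go (suc f) zero = 0
v₂go (suc f) (suc m) with suc m % 2
... | zero = suc (v₂go f (suc m / 2))
... | suc _ = 0

v₂ : ℕ → ℕ
v₂ n = v₂go n n

α₂ : (Fin 9 → ℕ) → ℕ
α₂ x = foldr (λ _ → ℕ) _⊔_ 0 (tabulate (λ i → v₂ (x i)))

IsSolution : (Fin 9 → ℕ) → Set
IsSolution x =
  Injective _≡_ _≡_ x
  × (∀ i → 0 Data.Nat.< x i)
  × sumRecip x ≡ 1q
  × (∃[ i ] 2 ∣ x i)
  × (∃[ p ] (Prime p × p ≢ 2 ×
       (∀ q → Prime q → (q ∣ prod x ⇔ (q ≡ 2 ⊎ q ≡ p)))))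

Has2 : (Fin 9 → ℕ) → Set
Has2 x = ∃[ i ] x i ≡ 2

solList : Vec ℕ 9
solList = 2 ∷ 3 ∷ 3 ^ 2 ∷ 3 ^ 3 ∷ 3 ^ 4 ∷ 3 ^ 5 ∷ 3 ^ 6 ∷ 3 ^ 7 ∷ 2 * 3 ^ 7 ∷ []

sol : Fin 9 → ℕ
sol i = V.lookup solList i

{-# OPTIONS --safe #-}
module Submission where

-- Write x_i = 2^{a_i} p^{b_i}; α₂ = 1 forces a_i ≤ 1.  With B = max b_i, multiplying
-- Σ 1/x_i = 1 by 2p^B gives Σ 2^{1-a_i} p^{B-b_i} = 2p^B.  Grouping the terms by the
-- level k = B - b_i, distinctness of the x_i makes the coefficient of p^k a digit
-- D_k = 2n₀ + n₁ ≤ 3, where n_c counts the i with a_i = c on level k.  Reading the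
-- expansion from the lowest level up, divisibility by p^{k+1} forces the first nonzero
-- digit to be 3 = p, every later one to be 2 (a carry 3^k + 2·3^k = 3^{k+1}) and the top
-- one to be 1; the only other expansion, the single digit 2 at level B, has one term
-- instead of nine.  Counting terms, 2 + (B - m - 1) + 1 = 9, so the levels are m, …, m + 7,
-- which gives X = {2, 3, …, 3⁶, 3⁷, 2·3⁷}; in particular 2 ∈ X, hence (i).

open import Defs
open import Algebra.Bundles using (CommutativeRing)
open import Data.Fin using (Fin; zero; suc; toℕ)
open import Data.Fin.Patterns
import Data.Fin.Properties as Fin
open import Data.Integer as ℤ using ()
import Data.Integer.Properties as ℤ
open import Data.List using ([]; _∷_)
open import Data.List.Relation.Unary.All using (All; []; _∷_)
open import Data.Nat
open import Data.Nat.Divisibility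
open import Data.Nat.DivMod using (_%_; _/_; m*n%n≡0; m*n/n≡m)
open import Data.Nat.ListAction using (product)
open import Data.Nat.Primality
open import Data.Nat.Primality.Factorisation using (factorise)
open import Data.Nat.Properties
open import Data.Nat.Solver using (module +-*-Solver)
open import Data.Product using (∃-syntax; _×_; _,_; proj₁; proj₂)
open import Data.Rational as ℚ using (ℚ; toℚᵘ)
import Data.Rational.Properties as ℚ
open import Data.Rational.Unnormalised as ℚᵘ using (ℚᵘ; mkℚᵘ; _≃_; *≡*)
import Data.Rational.Unnormalised.Properties as ℚᵘ
open import Data.Sum using (_⊎_; inj₁; inj₂; [_,_]′)
open import Data.Vec using (foldr; tabulate)
open import Function using (_∘_; id; _⇔_; Equivalence; mk⇔)
open import Function.Definitions using (Injective)
open import Relation.Binary.Definitions using (tri<; tri≈; tri>)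
open import Relation.Binary.PropositionalEquality
open import Relation.Nullary using (Dec; yes; no; ¬_; contradiction)
open import Relation.Nullary.Decidable using (from-yes; from-no; _→-dec_)
open import Algebra.Properties.Semiring.Sum +-*-semiring
  using (sum; sum-cong-≗; sum-remove; sum-replicate-zero; ∑-distrib-+; *-distribˡ-sum; *-distribʳ-sum)
open import Algebra.Properties.Semiring.Sum (CommutativeRing.semiring ℚᵘ.+-*-commutativeRing)
  using () renaming (sum to ∑ᵘ; sum-cong-≋ to ∑ᵘ-cong; *-distribˡ-sum to *-distribˡ-∑ᵘ)

-- Indicators and finite sums

𝟙 : ∀ {p} {P : Set p} → Dec P → ℕ
𝟙 (yes _) = 1
𝟙 (no _)  = 0

module _ {p} {P : Set p} where

  𝟙-yes : P → (d : Dec P) → 𝟙 d ≡ 1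
  𝟙-yes _ (yes _) = refl
  𝟙-yes x (no ¬x) = contradiction x ¬x

  𝟙-no : ¬ P → (d : Dec P) → 𝟙 d ≡ 0
  𝟙-no ¬x (yes x) = contradiction x ¬x
  𝟙-no _  (no _)  = refl

  𝟙≤1 : (d : Dec P) → 𝟙 d ≤ 1
  𝟙≤1 (yes _) = s≤s z≤n
  𝟙≤1 (no _)  = z≤n

𝟙*𝟙-pos : ∀ {p q} {P : Set p} {Q : Set q} (d : Dec P) (d′ : Dec Q) → 0 < 𝟙 d * 𝟙 d′ → P × Q
𝟙*𝟙-pos (yes x) (yes y) _ = x , y
𝟙*𝟙-pos (yes _) (no _)  ()
𝟙*𝟙-pos (no _)  _       ()

𝟙*𝟙≤1 : ∀ {p q} {P : Set p} {Q : Set q} (d : Dec P) (d′ : Dec Q) → 𝟙 d * 𝟙 d′ ≤ 1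
𝟙*𝟙≤1 d d′ = *-mono-≤ (𝟙≤1 d) (𝟙≤1 d′)

≤1⇒≡0⊎≡1 : ∀ {a} → a ≤ 1 → a ≡ 0 ⊎ a ≡ 1
≤1⇒≡0⊎≡1 z≤n       = inj₁ refl
≤1⇒≡0⊎≡1 (s≤s z≤n) = inj₂ refl

sum-pos : ∀ {n} (f : Fin n → ℕ) → 0 < sum f → ∃[ i ] 0 < f i
sum-pos {suc n} f 0<∑ with f zero in f₀≡
... | suc _ = zero , subst (0 <_) (sym f₀≡) (s≤s z≤n)
... | zero  with sum-pos (f ∘ suc) 0<∑
...   | i , 0<fi = suc i , 0<fi

≤-sum : ∀ {n} (f : Fin n → ℕ) i → f i ≤ sum f
≤-sum {suc n} f i = ≤-trans (m≤m+n (f i) _) (≤-reflexive (sym (sum-remove {i = i} f)))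

sum-zero : ∀ {n} {f : Fin n → ℕ} → (∀ i → f i ≡ 0) → sum f ≡ 0
sum-zero {n} f≡0 = trans (sum-cong-≗ f≡0) (sum-replicate-zero n)

sum≤1 : ∀ {n} (f : Fin n → ℕ) → (∀ i → f i ≤ 1) →
        (∀ i j → 0 < f i → 0 < f j → i ≡ j) → sum f ≤ 1
sum≤1 {zero}  f f≤1 unique = z≤n
sum≤1 {suc n} f f≤1 unique with f zero in f₀≡
... | zero  = sum≤1 (f ∘ suc) (f≤1 ∘ suc) λ i j 0<fi 0<fj → Fin.suc-injective (unique _ _ 0<fi 0<fj)
... | suc k = begin
  suc k + sum (f ∘ suc) ≡⟨ cong (suc k +_) (sum-zero rest≡0) ⟩
  suc k + 0             ≡⟨ +-identityʳ (suc k) ⟩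
  suc k                 ≤⟨ subst (_≤ 1) f₀≡ (f≤1 zero) ⟩
  1                     ∎
  where
  open ≤-Reasoning
  rest≡0 : ∀ j → f (suc j) ≡ 0
  rest≡0 j = n≤0⇒n≡0 (≮⇒≥ λ 0<fj →
    contradiction (unique zero (suc j) (subst (0 <_) (sym f₀≡) (s≤s z≤n)) 0<fj) λ ())

∣-foldr-* : ∀ {n} (f : Fin n → ℕ) i → f i ∣ foldr (λ _ → ℕ) _*_ 1 (tabulate f)
∣-foldr-* f zero    = m∣m*n _
∣-foldr-* f (suc i) = ∣n⇒∣m*n (f zero) (∣-foldr-* (f ∘ suc) i)

≤-foldr-⊔ : ∀ {n} (f : Fin n → ℕ) i → f i ≤ foldr (λ _ → ℕ) _⊔_ 0 (tabulate f)
≤-foldr-⊔ f zero    = m≤m⊔n _ _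
≤-foldr-⊔ f (suc i) = ≤-trans (≤-foldr-⊔ (f ∘ suc) i) (m≤n⊔m (f zero) _)

sum-[2u+v]*q : ∀ {n} (u v : Fin n → ℕ) q → sum (λ i → (2 * u i + v i) * q) ≡ (2 * sum u + sum v) * q
sum-[2u+v]*q u v q = begin
  sum (λ i → (2 * u i + v i) * q)   ≡⟨ *-distribʳ-sum q (λ i → 2 * u i + v i) ⟨
  sum (λ i → 2 * u i + v i) * q     ≡⟨ cong (_* q) (∑-distrib-+ (λ i → 2 * u i) v) ⟩
  (sum (λ i → 2 * u i) + sum v) * q ≡⟨ cong (λ s → (s + sum v) * q) (*-distribˡ-sum 2 u) ⟨
  (2 * sum u + sum v) * q           ∎
  where open ≡-Reasoning

-- Prime divisors

module _ {q : ℕ} (q-prime : Prime q) where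

  prime∣^⇒∣ : ∀ m k → q ∣ m ^ k → q ∣ m
  prime∣^⇒∣ m zero    q∣1 = contradiction (subst Prime (∣1⇒≡1 q∣1) q-prime) ¬prime[1]
  prime∣^⇒∣ m (suc k) q∣m^k+1 with euclidsLemma m (m ^ k) q-prime q∣m^k+1
  ... | inj₁ q∣m   = q∣m
  ... | inj₂ q∣m^k = prime∣^⇒∣ m k q∣m^k

  prime∣prime⇒≡ : ∀ {r} → Prime r → q ∣ r → q ≡ r
  prime∣prime⇒≡ r-prime q∣r with prime⇒irreducible r-prime q∣r
  ... | inj₁ q≡1 = contradiction (subst Prime q≡1 q-prime) ¬prime[1]
  ... | inj₂ q≡r = q≡r

  prime∣^*^ : ∀ {r s} → Prime r → Prime s → ∀ a b → q ∣ r ^ a * s ^ b → q ≡ r ⊎ q ≡ s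
  prime∣^*^ {r} {s} r-prime s-prime a b q∣ with euclidsLemma (r ^ a) (s ^ b) q-prime q∣
  ... | inj₁ q∣r^a = inj₁ (prime∣prime⇒≡ r-prime (prime∣^⇒∣ r a q∣r^a))
  ... | inj₂ q∣s^b = inj₂ (prime∣prime⇒≡ s-prime (prime∣^⇒∣ s b q∣s^b))

module _ (r s : ℕ) where

  private
    PrimeDivisorsIn : ℕ → Set
    PrimeDivisorsIn n = ∀ q → Prime q → q ∣ n → q ≡ r ⊎ q ≡ s

    TwoPrimePower : ℕ → Set
    TwoPrimePower n = ∃[ a ] ∃[ b ] n ≡ r ^ a * s ^ b

    product-twoPrimePower : ∀ {qs} → All Prime qs → PrimeDivisorsIn (product qs) →
                            TwoPrimePower (product qs)
    product-twoPrimePower []               _   = 0 , 0 , refl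
    product-twoPrimePower {q ∷ qs} (q-prime ∷ qs-prime) div
      with product-twoPrimePower qs-prime (λ q′ q′-prime q′∣ → div q′ q′-prime (∣n⇒∣m*n q q′∣))
         | div q q-prime (m∣m*n _)
    ... | a , b , eq | inj₁ refl = suc a , b , trans (cong (r *_) eq) (sym (*-assoc r (r ^ a) (s ^ b)))
    ... | a , b , eq | inj₂ refl = a , suc b , trans (cong (s *_) eq) (x*[y*z]≡y*[x*z] s (r ^ a) (s ^ b))
      where
      open +-*-Solver
      x*[y*z]≡y*[x*z] : ∀ x y z → x * (y * z) ≡ y * (x * z)
      x*[y*z]≡y*[x*z] = solve 3 (λ x y z → x :* (y :* z) := y :* (x :* z)) refl

  twoPrimePower : ∀ n → 0 < n → PrimeDivisorsIn n → TwoPrimePower n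
  twoPrimePower n 0<n div with factorise n {{>-nonZero 0<n}}
  ... | record { factors = qs ; isFactorisation = n≡∏qs ; factorsPrime = qs-prime }
    with product-twoPrimePower qs-prime (λ q q-prime q∣ → div q q-prime (subst (q ∣_) (sym n≡∏qs) q∣))
  ... | a , b , eq = a , b , trans n≡∏qs eq

-- Sums over initial segments of ℕ and base-p expansions

∑< : (ℕ → ℕ) → ℕ → ℕ
∑< f zero    = 0
∑< f (suc k) = ∑< f k + f k

∑<-split : ∀ f k d → ∑< f (d + k) ≡ ∑< f k + ∑< (λ j → f (j + k)) d
∑<-split f k zero    = sym (+-identityʳ (∑< f k))
∑<-split f k (suc d) = trans (cong (_+ f (d + k)) (∑<-split f k d)) (+-assoc (∑< f k) _ _)

∑<-const : ∀ {c} f d → (∀ j → j < d → f j ≡ c) → ∑< f d ≡ d * c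
∑<-const f zero    f≡c = refl
∑<-const {c} f (suc d) f≡c = begin
  ∑< f d + f d ≡⟨ cong₂ _+_ (∑<-const f d (λ j j<d → f≡c j (m<n⇒m<1+n j<d))) (f≡c d (n<1+n d)) ⟩
  d * c + c    ≡⟨ +-comm (d * c) c ⟩
  suc d * c    ∎
  where open ≡-Reasoning

∑<-∣ : ∀ {m} f k → (∀ j → j < k → m ∣ f j) → m ∣ ∑< f k
∑<-∣ f zero    m∣f = _ ∣0
∑<-∣ f (suc k) m∣f = ∣m∣n⇒∣m+n (∑<-∣ f k (λ j j<k → m∣f j (m<n⇒m<1+n j<k))) (m∣f k (n<1+n k))

^-monoʳ-∣ : ∀ m {j k} → j ≤ k → m ^ j ∣ m ^ k
^-monoʳ-∣ m {j} {k} j≤k =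
  divides (m ^ (k ∸ j)) (trans (cong (m ^_) (sym (m∸n+n≡m j≤k))) (^-distribˡ-+-* m (k ∸ j) j))

∑<-cong : ∀ {f g} → (∀ j → f j ≡ g j) → ∀ k → ∑< f k ≡ ∑< g k
∑<-cong f≡g zero    = refl
∑<-cong f≡g (suc k) = cong₂ _+_ (∑<-cong f≡g k) (f≡g k)

module Expansion (p : ℕ) (3≤p : 3 ≤ p) (D : ℕ → ℕ) (D≤3 : ∀ k → D k ≤ 3) where

  private instance
    p≢0 : NonZero p
    p≢0 = >-nonZero (≤-trans (s≤s z≤n) 3≤p)

  value : ℕ → ℕ
  value = ∑< (λ j → D j * p ^ j)

  Zeros : ℕ → Set
  Zeros k = ∀ j → j < k → D j ≡ 0

  record Chain (m k : ℕ) : Set where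
    field
      p≡3   : p ≡ 3
      m<k   : m < k
      zeros : Zeros m
      three : D m ≡ 3
      twos  : ∀ j → j < k → m < j → D j ≡ 2

  p^k∣value : ∀ {B} → value (suc B) ≡ 2 * p ^ B → ∀ k → k ≤ B → p ^ k ∣ value k
  p^k∣value {B} value≡ k k≤B = ∣m+n∣m⇒∣n p^k∣total p^k∣rest
    where
    d rest : ℕ
    d = suc B ∸ k
    rest = ∑< (λ j → D (j + k) * p ^ (j + k)) d
    p^k∣rest : p ^ k ∣ rest
    p^k∣rest = ∑<-∣ _ d λ j _ → ∣n⇒∣m*n (D (j + k)) (^-monoʳ-∣ p (m≤n+m k j))
    p^k∣total : p ^ k ∣ rest + value k
    p^k∣total = subst (p ^ k ∣_) (begin
      2 * p ^ B                    ≡⟨ value≡ ⟨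
      value (suc B)                ≡⟨ cong value (m∸n+n≡m (m≤n⇒m≤1+n k≤B)) ⟨
      value (d + k)                ≡⟨ ∑<-split _ k d ⟩
      value k + rest               ≡⟨ +-comm (value k) rest ⟩
      rest + value k               ∎)
      (∣n⇒∣m*n 2 (^-monoʳ-∣ p k≤B))
      where open ≡-Reasoning

  private
    ∣∧≤3⇒ : ∀ {d} → p ∣ d → d ≤ 3 → d ≡ 0 ⊎ (d ≡ 3 × p ≡ 3)
    ∣∧≤3⇒ {zero}  _   _   = inj₁ refl
    ∣∧≤3⇒ {suc d} p∣d d≤3 = inj₂ (≤-antisym d≤3 (≤-trans 3≤p p≤d) , ≤-antisym (≤-trans p≤d d≤3) 3≤p)
      where
      p≤d : p ≤ suc d
      p≤d = ∣⇒≤ p∣d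

    3∣1+d⇒d≡2 : ∀ {d} → 3 ∣ suc d → d ≤ 3 → d ≡ 2
    3∣1+d⇒d≡2 {0} 3∣1 _ = contradiction 3∣1 (from-no (3 ∣? 1))
    3∣1+d⇒d≡2 {1} 3∣2 _ = contradiction 3∣2 (from-no (3 ∣? 2))
    3∣1+d⇒d≡2 {2} _   _ = refl
    3∣1+d⇒d≡2 {3} 3∣4 _ = contradiction 3∣4 (from-no (3 ∣? 4))
    3∣1+d⇒d≡2 {suc (suc (suc (suc _)))} _ (s≤s (s≤s (s≤s ())))

    Invariant : ℕ → Set
    Invariant k = (Zeros k × value k ≡ 0) ⊎ (∃[ m ] Chain m k × value k ≡ 3 ^ k)

    extend : ∀ {k} {P : ℕ → Set} → (∀ j → j < k → P j) → P k → ∀ j → j < suc k → P j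
    extend {k} below here j j<1+k with m<1+n⇒m<n∨m≡n j<1+k
    ... | inj₁ j<k  = below j j<k
    ... | inj₂ refl = here

    step : ∀ {k} → p ^ suc k ∣ value (suc k) → Invariant k → Invariant (suc k)
    step {k} p^k+1∣ (inj₁ (zeros , value≡0)) with ∣∧≤3⇒ (*-cancelʳ-∣ (p ^ k) {{m^n≢0 p k}} p^k+1∣′) (D≤3 k)
      where
      p^k+1∣′ : p * p ^ k ∣ D k * p ^ k
      p^k+1∣′ = subst (p ^ suc k ∣_) (cong (_+ D k * p ^ k) value≡0) p^k+1∣
    ... | inj₁ Dk≡0 = inj₁ (extend zeros Dk≡0 , cong₂ (λ v d → v + d * p ^ k) value≡0 Dk≡0)
    ... | inj₂ (Dk≡3 , refl) = inj₂ (k , chain , cong₂ (λ v d → v + d * 3 ^ k) value≡0 Dk≡3)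
      where
      chain : Chain k (suc k)
      chain = record { p≡3 = refl ; m<k = n<1+n k ; zeros = zeros ; three = Dk≡3
                     ; twos = λ j j<1+k k<j → contradiction (≤-pred j<1+k) (<⇒≱ k<j) }
    step {k} p^k+1∣ (inj₂ (m , chain , value≡3^k)) with Chain.p≡3 chain
    ... | refl = inj₂ (m , chain′ , value≡3^k+1)
      where
      open Chain chain
      value≡ : value (suc k) ≡ suc (D k) * 3 ^ k
      value≡ = cong (_+ D k * 3 ^ k) value≡3^k
      Dk≡2 : D k ≡ 2
      Dk≡2 = 3∣1+d⇒d≡2 (*-cancelʳ-∣ (3 ^ k) {{m^n≢0 3 k}} (subst (3 ^ suc k ∣_) value≡ p^k+1∣)) (D≤3 k)
      value≡3^k+1 : value (suc k) ≡ 3 ^ suc k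
      value≡3^k+1 = trans value≡ (cong (λ d → suc d * 3 ^ k) Dk≡2)
      chain′ : Chain m (suc k)
      chain′ = record { p≡3 = refl ; m<k = m<n⇒m<1+n m<k ; zeros = zeros ; three = three
                      ; twos = extend twos (λ _ → Dk≡2) }

    invariant : ∀ {B} → value (suc B) ≡ 2 * p ^ B → ∀ k → k ≤ B → Invariant k
    invariant value≡ zero    _   = inj₁ ((λ _ ()) , refl)
    invariant value≡ (suc k) k<B =
      step (p^k∣value value≡ (suc k) k<B) (invariant value≡ k (<⇒≤ k<B))

  expansions-of-2p^B : ∀ {B} → value (suc B) ≡ 2 * p ^ B →
                       (Zeros B × D B ≡ 2) ⊎ (∃[ m ] Chain m B × D B ≡ 1)
  expansions-of-2p^B {B} value≡ with invariant value≡ B ≤-refl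
  ... | inj₁ (zeros , value≡0) =
    inj₁ (zeros , *-cancelʳ-≡ (D B) 2 (p ^ B) {{m^n≢0 p B}} (trans (cong (_+ D B * p ^ B) (sym value≡0)) value≡))
  ... | inj₂ (m , chain , value≡3^B) with Chain.p≡3 chain
  ...   | refl = inj₂ (m , chain ,
    suc-injective (*-cancelʳ-≡ (suc (D B)) 2 (3 ^ B) {{m^n≢0 3 B}} (trans (cong (_+ D B * 3 ^ B) (sym value≡3^B)) value≡)))

  ∑<-zeros : ∀ g → g 0 ≡ 0 → ∀ {k} → Zeros k → ∑< (g ∘ D) k ≡ 0
  ∑<-zeros g g0≡0 {k} zeros =
    trans (∑<-const (g ∘ D) k λ j j<k → trans (cong g (zeros j j<k)) g0≡0) (*-zeroʳ k)

  ∑<-chain : ∀ g → g 0 ≡ 0 → ∀ {m k} → Chain m k → ∑< (g ∘ D) k ≡ g 3 + (k ∸ suc m) * g 2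
  ∑<-chain g g0≡0 {m} {k} chain = begin
    ∑< (g ∘ D) k                   ≡⟨ cong (∑< (g ∘ D)) (m∸n+n≡m m<k) ⟨
    ∑< (g ∘ D) (d + suc m)         ≡⟨ ∑<-split (g ∘ D) (suc m) d ⟩
    ∑< (g ∘ D) m + g (D m) + rest  ≡⟨ cong₂ (λ u v → u + g v + rest) (∑<-zeros g g0≡0 zeros) three ⟩
    g 3 + rest                     ≡⟨ cong (g 3 +_) (∑<-const _ d λ j j<d → cong g (twos _ (j+1+m<k j<d) (m≤n+m (suc m) j))) ⟩
    g 3 + d * g 2                  ∎
    where
    open ≡-Reasoning
    open Chain chain
    d rest : ℕ
    d = k ∸ suc m
    rest = ∑< (λ j → g (D (j + suc m))) d
    j+1+m<k : ∀ {j} → j < d → j + suc m < k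
    j+1+m<k {j} j<d = subst (j + suc m <_) (m∸n+n≡m m<k) (+-monoˡ-< (suc m) j<d)

-- Clearing denominators

ι : ℕ → ℚᵘ
ι n = mkℚᵘ (ℤ.+ n) 0

ι-injective : ∀ {m n} → ι m ≃ ι n → m ≡ n
ι-injective {m} {n} (*≡* eq) =
  ℤ.+-injective (trans (sym (ℤ.*-identityʳ (ℤ.+ m))) (trans eq (ℤ.*-identityʳ (ℤ.+ n))))

ι-+ : ∀ m n → ι (m + n) ≃ ι m ℚᵘ.+ ι n
ι-+ m n = *≡* (cong (ℤ._* ℤ.+ 1) (trans (ℤ.pos-+ m n)
                (sym (cong₂ ℤ._+_ (ℤ.*-identityʳ (ℤ.+ m)) (ℤ.*-identityʳ (ℤ.+ n))))))

ι-sum : ∀ {n} (f : Fin n → ℕ) → ι (sum f) ≃ ∑ᵘ (ι ∘ f)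
ι-sum {zero}  f = ℚᵘ.≃-refl
ι-sum {suc n} f = ℚᵘ.≃-trans (ι-+ (f zero) _) (ℚᵘ.+-congʳ (ι (f zero)) (ι-sum (f ∘ suc)))

toℚᵘ-foldr-+ : ∀ {n} (f : Fin n → ℚ) → toℚᵘ (foldr (λ _ → ℚ) ℚ._+_ ℚ.0ℚ (tabulate f)) ≃ ∑ᵘ (toℚᵘ ∘ f)
toℚᵘ-foldr-+ {zero}  f = ℚᵘ.≃-refl
toℚᵘ-foldr-+ {suc n} f =
  ℚᵘ.≃-trans (ℚ.toℚᵘ-homo-+ (f zero) _) (ℚᵘ.+-congʳ (toℚᵘ (f zero)) (toℚᵘ-foldr-+ (f ∘ suc)))

ι*recip : ∀ {t x N} → 0 < x → t * x ≡ N → ι N ℚᵘ.* toℚᵘ (recip x) ≃ ι t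
-- recip (suc x) is definitionally fromℚᵘ (mkℚᵘ (+ 1) x).
ι*recip {t} {suc x} {N} _ t*x≡N =
  ℚᵘ.≃-trans (ℚᵘ.*-congˡ {ι N} (ℚ.toℚᵘ-fromℚᵘ (mkℚᵘ (ℤ.+ 1) x))) (*≡* cross)
  where
  open ≡-Reasoning
  cross : ℤ.+ N ℤ.* ℤ.+ 1 ℤ.* ℤ.+ 1 ≡ ℤ.+ t ℤ.* ℤ.+ (1 * suc x)
  cross = begin
    ℤ.+ N ℤ.* ℤ.+ 1 ℤ.* ℤ.+ 1 ≡⟨ trans (ℤ.*-identityʳ _) (ℤ.*-identityʳ (ℤ.+ N)) ⟩
    ℤ.+ N                     ≡⟨ cong ℤ.+_ (trans (sym t*x≡N) (cong (t *_) (sym (*-identityˡ (suc x))))) ⟩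
    ℤ.+ (t * (1 * suc x))     ≡⟨ ℤ.pos-* t (1 * suc x) ⟩
    ℤ.+ t ℤ.* ℤ.+ (1 * suc x) ∎

clear-denominators : ∀ {n} (x t : Fin n → ℕ) {N} → (∀ i → 0 < x i) → (∀ i → t i * x i ≡ N) →
                     foldr (λ _ → ℚ) ℚ._+_ ℚ.0ℚ (tabulate (recip ∘ x)) ≡ ℚ.1ℚ → sum t ≡ N
clear-denominators {n} x t {N} x>0 t*x≡N ∑recip≡1 = sym (ι-injective (begin
  ι N                       ≈⟨ ℚᵘ.*-identityʳ (ι N) ⟨
  ι N ℚᵘ.* ℚᵘ.1ℚᵘ           ≈⟨ ℚᵘ.*-congˡ {ι N} ∑r≃1 ⟨
  ι N ℚᵘ.* ∑ᵘ r             ≈⟨ *-distribˡ-∑ᵘ (ι N) r ⟩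
  ∑ᵘ (λ i → ι N ℚᵘ.* r i)   ≈⟨ ∑ᵘ-cong (λ i → ι*recip (x>0 i) (t*x≡N i)) ⟩
  ∑ᵘ (ι ∘ t)                ≈⟨ ι-sum t ⟨
  ι (sum t)                 ∎))
  where
  open ℚᵘ.≃-Reasoning
  r : Fin n → ℚᵘ
  r = toℚᵘ ∘ recip ∘ x
  ∑r≃1 : ∑ᵘ r ≃ ℚᵘ.1ℚᵘ
  ∑r≃1 = ℚᵘ.≃-trans (ℚᵘ.≃-sym (toℚᵘ-foldr-+ (recip ∘ x))) (ℚ.toℚᵘ-cong ∑recip≡1)

-- The 2-adic valuation

v₂go-even : ∀ f m → suc m % 2 ≡ 0 → v₂go (suc f) (suc m) ≡ suc (v₂go f (suc m / 2))
v₂go-even f m even rewrite even = refl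

1≤v₂go : ∀ f m → 1 ≤ v₂go (suc f) (suc m * 2)
1≤v₂go f m = subst (1 ≤_) (sym (v₂go-even f (suc (m * 2)) (m*n%n≡0 (suc m) 2))) (s≤s z≤n)

2≤v₂ : ∀ m → 2 ≤ v₂ (suc m * 2 * 2)
2≤v₂ m = begin
  2                               ≤⟨ s≤s (1≤v₂go (pred (pred n)) m) ⟩
  suc (v₂go (pred n) (suc m * 2)) ≡⟨ cong (λ z → suc (v₂go (pred n) z)) (m*n/n≡m (suc m * 2) 2) ⟨
  suc (v₂go (pred n) (n / 2))     ≡⟨ v₂go-even (pred n) (pred n) (m*n%n≡0 (suc m * 2) 2) ⟨
  v₂ n                            ∎
  where
  open ≤-Reasoning
  n : ℕ
  n = suc m * 2 * 2

v₂≤1⇒≤1 : ∀ a y → 0 < y → v₂ (2 ^ a * y) ≤ 1 → a ≤ 1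
v₂≤1⇒≤1 zero          y _   _    = z≤n
v₂≤1⇒≤1 (suc zero)    y _   _    = s≤s z≤n
v₂≤1⇒≤1 (suc (suc c)) y 0<y v₂≤1 = contradiction (≤-trans (2≤v₂ (pred m)) (≤-reflexive (cong v₂ x≡))) (<⇒≱ (s≤s v₂≤1))
  where
  open +-*-Solver
  m : ℕ
  m = 2 ^ c * y
  x≡ : suc (pred m) * 2 * 2 ≡ 2 ^ suc (suc c) * y
  x≡ = trans (cong (λ z → z * 2 * 2) (suc-pred m {{m*n≢0 (2 ^ c) y {{m^n≢0 2 c}} {{>-nonZero 0<y}}}}))
             (solve 2 (λ u v → u :* v :* con 2 :* con 2 := con 2 :* (con 2 :* u) :* v) refl (2 ^ c) y)

-- Grouping terms by level

𝟙<-suc : ∀ e k y → 𝟙 (e <? suc k) * y ≡ 𝟙 (e <? k) * y + 𝟙 (e ≟ k) * y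
𝟙<-suc e k y with <-cmp e k
... | tri< e<k e≢k _
  rewrite 𝟙-yes (m<n⇒m<1+n e<k) (e <? suc k) | 𝟙-yes e<k (e <? k) | 𝟙-no e≢k (e ≟ k) = sym (+-identityʳ _)
... | tri≈ e≮k refl _
  rewrite 𝟙-yes (n<1+n e) (e <? suc e) | 𝟙-no e≮k (e <? e) | 𝟙-yes refl (e ≟ e) = refl
... | tri> e≮k e≢k k<e
  rewrite 𝟙-no (<⇒≱ k<e ∘ ≤-pred) (e <? suc k) | 𝟙-no e≮k (e <? k) | 𝟙-no e≢k (e ≟ k) = refl

module _ {n} (e : Fin n → ℕ) where

  level : (Fin n → ℕ) → ℕ → ℕ
  level y k = sum (λ i → 𝟙 (e i ≟ k) * y i)

  sum-below≡∑<-level : ∀ y K → sum (λ i → 𝟙 (e i <? K) * y i) ≡ ∑< (level y) K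
  sum-below≡∑<-level y zero    = sum-zero λ i → cong (_* y i) (𝟙-no (λ ()) (e i <? 0))
  sum-below≡∑<-level y (suc K) = begin
    sum (λ i → 𝟙 (e i <? suc K) * y i)                 ≡⟨ sum-cong-≗ (λ i → 𝟙<-suc (e i) K (y i)) ⟩
    sum (λ i → 𝟙 (e i <? K) * y i + 𝟙 (e i ≟ K) * y i)  ≡⟨ ∑-distrib-+ (λ i → 𝟙 (e i <? K) * y i) (λ i → 𝟙 (e i ≟ K) * y i) ⟩
    sum (λ i → 𝟙 (e i <? K) * y i) + level y K         ≡⟨ cong (_+ level y K) (sum-below≡∑<-level y K) ⟩
    ∑< (level y) K + level y K                         ∎
    where open ≡-Reasoning

  sum≡∑<-level : ∀ {B} → (∀ i → e i ≤ B) → ∀ y → sum y ≡ ∑< (level y) (suc B)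
  sum≡∑<-level {B} e≤B y = trans (sum-cong-≗ all-below) (sum-below≡∑<-level y (suc B))
    where
    all-below : ∀ i → y i ≡ 𝟙 (e i <? suc B) * y i
    all-below i = sym (trans (cong (_* y i) (𝟙-yes (s≤s (e≤B i)) (e i <? suc B))) (*-identityˡ (y i)))

level-term : ∀ p e k a → a ≤ 1 →
  𝟙 (e ≟ k) * (2 ^ (1 ∸ a) * p ^ e) ≡ (2 * (𝟙 (e ≟ k) * 𝟙 (a ≟ 0)) + 𝟙 (e ≟ k) * 𝟙 (a ≟ 1)) * p ^ k
level-term p e k a a≤1 with e ≟ k
level-term p e .e .0 z≤n       | yes refl = *-identityˡ _
level-term p e .e .1 (s≤s z≤n) | yes refl = *-identityˡ _
level-term p e k  a  _         | no _     = refl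

level-count-term : ∀ e k a → a ≤ 1 → 𝟙 (e ≟ k) * 1 ≡ 𝟙 (e ≟ k) * 𝟙 (a ≟ 0) + 𝟙 (e ≟ k) * 𝟙 (a ≟ 1)
level-count-term e k a a≤1 with e ≟ k
level-count-term e .e .0 z≤n       | yes refl = refl
level-count-term e .e .1 (s≤s z≤n) | yes refl = refl
level-count-term e k  a  _         | no _     = refl

bits-of-digit : ∀ {a b} → a ≤ 1 → b ≤ 1 → a ≡ (2 * a + b) / 2 × b ≡ (2 * a + b) % 2
bits-of-digit z≤n       z≤n       = refl , refl
bits-of-digit z≤n       (s≤s z≤n) = refl , refl
bits-of-digit (s≤s z≤n) z≤n       = refl , refl
bits-of-digit (s≤s z≤n) (s≤s z≤n) = refl , refl

sol-injective : Injective _≡_ _≡_ sol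
sol-injective {i} {j} = from-yes (Fin.all? λ i → Fin.all? λ j → (sol i ≟ sol j) →-dec (i Fin.≟ j)) i j

sol>0 : ∀ j → 0 < sol j
sol>0 = from-yes (Fin.all? λ j → 0 <? sol j)

prime[3] : Prime 3
prime[3] = from-yes (prime? 3)

sol-prime-divisors : ∀ q → Prime q → (q ∣ prod sol ⇔ (q ≡ 2 ⊎ q ≡ 3))
sol-prime-divisors q q-prime = mk⇔ (prime∣^*^ q-prime prime[2] prime[3] 2 35) λ where
  (inj₁ refl) → ∣-foldr-* sol 0F
  (inj₂ refl) → ∣-foldr-* sol 1F

sol-isSolution : IsSolution sol
sol-isSolution = sol-injective , sol>0 , refl , (0F , ∣-refl) , 3 , prime[3] , (λ ()) , sol-prime-divisors

sol-3^ : ∀ r → 0 < r → r ≤ 6 → ∃[ j ] sol j ≡ 2 ^ 0 * 3 ^ r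
sol-3^ 1 _ _ = 1F , refl
sol-3^ 2 _ _ = 2F , refl
sol-3^ 3 _ _ = 3F , refl
sol-3^ 4 _ _ = 4F , refl
sol-3^ 5 _ _ = 5F , refl
sol-3^ 6 _ _ = 6F , refl
sol-3^ (suc (suc (suc (suc (suc (suc (suc _))))))) _ (s≤s (s≤s (s≤s (s≤s (s≤s (s≤s ()))))))

-- Classification of the solutions with α₂ = 1

module Classification
  (x : Fin 9 → ℕ) (x-injective : Injective _≡_ _≡_ x) (x>0 : ∀ i → 0 < x i)
  (∑1/x≡1 : sumRecip x ≡ ℚ.1ℚ) (p : ℕ) (p-prime : Prime p) (p≢2 : p ≢ 2)
  (prime-divisors : ∀ q → Prime q → (q ∣ prod x ⇔ (q ≡ 2 ⊎ q ≡ p))) (α₂≡1 : α₂ x ≡ 1)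
  where

  3≤p : 3 ≤ p
  3≤p = ≤∧≢⇒< (nonTrivial⇒n>1 p {{prime⇒nonTrivial p-prime}}) (p≢2 ∘ sym)

  instance
    p≢0 : NonZero p
    p≢0 = prime⇒nonZero p-prime

  decomposition : ∀ i → ∃[ a ] ∃[ b ] x i ≡ 2 ^ a * p ^ b
  decomposition i = twoPrimePower 2 p (x i) (x>0 i) λ q q-prime q∣xᵢ →
    Equivalence.to (prime-divisors q q-prime) (∣-trans q∣xᵢ (∣-foldr-* x i))

  -- Opaque: letting the type checker unfold the prime factorisation is prohibitively slow.
  opaque
    a b : Fin 9 → ℕ
    a i = proj₁ (decomposition i)
    b i = proj₁ (proj₂ (decomposition i))

    x≡2^a*p^b : ∀ i → x i ≡ 2 ^ a i * p ^ b i
    x≡2^a*p^b i = proj₂ (proj₂ (decomposition i))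

  a≤1 : ∀ i → a i ≤ 1
  a≤1 i = v₂≤1⇒≤1 (a i) (p ^ b i) (>-nonZero⁻¹ _ {{m^n≢0 p (b i)}})
    (subst (λ y → v₂ y ≤ 1) (x≡2^a*p^b i) (subst (v₂ (x i) ≤_) α₂≡1 (≤-foldr-⊔ (v₂ ∘ x) i)))

  opaque
    B : ℕ
    B = foldr (λ _ → ℕ) _⊔_ 0 (tabulate b)

    b≤B : ∀ i → b i ≤ B
    b≤B = ≤-foldr-⊔ b

  e : Fin 9 → ℕ
  e i = B ∸ b i

  e≤B : ∀ i → e i ≤ B
  e≤B i = m∸n≤m B (b i)

  b≡B∸e : ∀ i → b i ≡ B ∸ e i
  b≡B∸e i = sym (m∸[m∸n]≡n (b≤B i))

  t : Fin 9 → ℕ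
  t i = 2 ^ (1 ∸ a i) * p ^ e i

  t*x≡2p^B : ∀ i → t i * x i ≡ 2 * p ^ B
  t*x≡2p^B i = begin
    2 ^ (1 ∸ a i) * p ^ e i * x i                     ≡⟨ cong (2 ^ (1 ∸ a i) * p ^ e i *_) (x≡2^a*p^b i) ⟩
    2 ^ (1 ∸ a i) * p ^ e i * (2 ^ a i * p ^ b i)     ≡⟨ interchange (2 ^ (1 ∸ a i)) (p ^ e i) (2 ^ a i) (p ^ b i) ⟩
    2 ^ (1 ∸ a i) * 2 ^ a i * (p ^ e i * p ^ b i)     ≡⟨ cong₂ _*_ (^-distribˡ-+-* 2 (1 ∸ a i) (a i)) (^-distribˡ-+-* p (e i) (b i)) ⟨
    2 ^ (1 ∸ a i + a i) * p ^ (e i + b i)             ≡⟨ cong₂ (λ u v → 2 ^ u * p ^ v) (m∸n+n≡m (a≤1 i)) (m∸n+n≡m (b≤B i)) ⟩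
    2 * p ^ B                                         ∎
    where
    open ≡-Reasoning
    open +-*-Solver
    interchange : ∀ u v w z → u * v * (w * z) ≡ u * w * (v * z)
    interchange = solve 4 (λ u v w z → u :* v :* (w :* z) := u :* w :* (v :* z)) refl

  ∑t≡2p^B : sum t ≡ 2 * p ^ B
  ∑t≡2p^B = clear-denominators x t x>0 t*x≡2p^B ∑1/x≡1

  count : ℕ → ℕ → ℕ
  count c k = sum (λ i → 𝟙 (e i ≟ k) * 𝟙 (a i ≟ c))

  count≤1 : ∀ c k → count c k ≤ 1
  count≤1 c k = sum≤1 _ (λ i → 𝟙*𝟙≤1 (e i ≟ k) (a i ≟ c)) λ i j 0<ᵢ 0<ⱼ →
    let eᵢ≡k , aᵢ≡c = 𝟙*𝟙-pos (e i ≟ k) (a i ≟ c) 0<ᵢ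
        eⱼ≡k , aⱼ≡c = 𝟙*𝟙-pos (e j ≟ k) (a j ≟ c) 0<ⱼ
    in x-injective (begin
      x i                          ≡⟨ x≡2^a*p^b i ⟩
      2 ^ a i * p ^ b i            ≡⟨ cong (λ u → 2 ^ a i * p ^ u) (b≡B∸e i) ⟩
      2 ^ a i * p ^ (B ∸ e i)      ≡⟨ cong₂ (λ u v → 2 ^ u * p ^ (B ∸ v)) (trans aᵢ≡c (sym aⱼ≡c)) (trans eᵢ≡k (sym eⱼ≡k)) ⟩
      2 ^ a j * p ^ (B ∸ e j)      ≡⟨ cong (λ u → 2 ^ a j * p ^ u) (b≡B∸e j) ⟨
      2 ^ a j * p ^ b j            ≡⟨ x≡2^a*p^b j ⟨
      x j                          ∎)
    where open ≡-Reasoning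

  digit : ℕ → ℕ
  digit k = 2 * count 0 k + count 1 k

  digit≤3 : ∀ k → digit k ≤ 3
  digit≤3 k = +-mono-≤ (*-monoʳ-≤ 2 (count≤1 0 k)) (count≤1 1 k)

  open Expansion p 3≤p digit digit≤3

  level-t : ∀ k → level e t k ≡ digit k * p ^ k
  level-t k = trans (sum-cong-≗ λ i → level-term p (e i) k (a i) (a≤1 i))
                    (sum-[2u+v]*q (λ i → 𝟙 (e i ≟ k) * 𝟙 (a i ≟ 0)) (λ i → 𝟙 (e i ≟ k) * 𝟙 (a i ≟ 1)) (p ^ k))

  level-count : ∀ k → level e (λ _ → 1) k ≡ count 0 k + count 1 k
  level-count k = trans (sum-cong-≗ λ i → level-count-term (e i) k (a i) (a≤1 i))
                        (∑-distrib-+ (λ i → 𝟙 (e i ≟ k) * 𝟙 (a i ≟ 0)) (λ i → 𝟙 (e i ≟ k) * 𝟙 (a i ≟ 1)))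

  value≡2p^B : value (suc B) ≡ 2 * p ^ B
  value≡2p^B = begin
    value (suc B)               ≡⟨ ∑<-cong level-t (suc B) ⟨
    ∑< (level e t) (suc B)      ≡⟨ sum≡∑<-level e e≤B t ⟨
    sum t                       ≡⟨ ∑t≡2p^B ⟩
    2 * p ^ B                   ∎
    where open ≡-Reasoning

  ∑<-count≡9 : ∑< (λ k → count 0 k + count 1 k) (suc B) ≡ 9
  ∑<-count≡9 = begin
    ∑< (λ k → count 0 k + count 1 k) (suc B) ≡⟨ ∑<-cong level-count (suc B) ⟨
    ∑< (level e (λ _ → 1)) (suc B)           ≡⟨ sum≡∑<-level e e≤B (λ _ → 1) ⟨
    9                                        ∎
    where open ≡-Reasoning

  -- The number of terms behind a digit 2 n₀ + n₁ with n₀, n₁ ≤ 1.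
  weight : ℕ → ℕ
  weight d = d / 2 + d % 2

  count₀≡ : ∀ {k d} → digit k ≡ d → count 0 k ≡ d / 2
  count₀≡ {k} refl = proj₁ (bits-of-digit (count≤1 0 k) (count≤1 1 k))

  count₁≡ : ∀ {k d} → digit k ≡ d → count 1 k ≡ d % 2
  count₁≡ {k} refl = proj₂ (bits-of-digit (count≤1 0 k) (count≤1 1 k))

  ∑<-weight≡9 : ∑< (weight ∘ digit) (suc B) ≡ 9
  ∑<-weight≡9 = trans (∑<-cong (λ k → sym (cong₂ _+_ (count₀≡ refl) (count₁≡ refl))) (suc B)) ∑<-count≡9

  single-digit-impossible : ¬ (Zeros B × digit B ≡ 2)
  single-digit-impossible (zeros , digit≡2) = contradiction (begin
    1                                         ≡⟨ cong₂ (λ s d → s + weight d) (∑<-zeros weight refl zeros) digit≡2 ⟨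
    ∑< (weight ∘ digit) B + weight (digit B)  ≡⟨ ∑<-weight≡9 ⟩
    9                                         ∎) λ ()
    where open ≡-Reasoning

  opaque
    chain : ∃[ m ] Chain m B × digit B ≡ 1
    chain = [ (λ single → contradiction single single-digit-impossible) , id ]′ (expansions-of-2p^B value≡2p^B)

  m : ℕ
  m = proj₁ chain

  open Chain (proj₁ (proj₂ chain))

  top : digit B ≡ 1
  top = proj₂ (proj₂ chain)

  B∸1+m≡6 : B ∸ suc m ≡ 6
  B∸1+m≡6 = trans (sym (*-identityʳ d)) (+-cancelʳ-≡ 1 (d * 1) 6 (suc-injective (suc-injective 2+d+1≡9)))
    where
    open ≡-Reasoning
    d : ℕ
    d = B ∸ suc m
    2+d+1≡9 : 2 + d * 1 + 1 ≡ 9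
    2+d+1≡9 = begin
      2 + d * 1 + 1                             ≡⟨ cong₂ (λ s w → s + weight w) (∑<-chain weight refl (proj₁ (proj₂ chain))) top ⟨
      ∑< (weight ∘ digit) B + weight (digit B)  ≡⟨ ∑<-weight≡9 ⟩
      9                                         ∎

  B≡m+7 : B ≡ m + 7
  B≡m+7 = trans (sym (m∸n+n≡m m<k)) (trans (cong (_+ suc m) B∸1+m≡6) (+-comm 7 m))

  x≡2^a*3^[B∸e] : ∀ i → x i ≡ 2 ^ a i * 3 ^ (B ∸ e i)
  x≡2^a*3^[B∸e] i = trans (x≡2^a*p^b i) (cong₂ (λ q u → 2 ^ a i * q ^ u) p≡3 (b≡B∸e i))

  count-self : ∀ i → count (a i) (e i) ≡ 1
  count-self i = ≤-antisym (count≤1 (a i) (e i))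
    (subst (_≤ count (a i) (e i)) self≡1 (≤-sum (λ j → 𝟙 (e j ≟ e i) * 𝟙 (a j ≟ a i)) i))
    where
    self≡1 : 𝟙 (e i ≟ e i) * 𝟙 (a i ≟ a i) ≡ 1
    self≡1 = cong₂ _*_ (𝟙-yes refl (e i ≟ e i)) (𝟙-yes refl (a i ≟ a i))

  occupied : ∀ i → (a i ≡ 0 × digit (e i) / 2 ≡ 1) ⊎ (a i ≡ 1 × digit (e i) % 2 ≡ 1)
  occupied i with ≤1⇒≡0⊎≡1 (a≤1 i)
  ... | inj₁ a≡0 = inj₁ (a≡0 , trans (sym (count₀≡ refl)) (subst (λ c → count c (e i) ≡ 1) a≡0 (count-self i)))
  ... | inj₂ a≡1 = inj₂ (a≡1 , trans (sym (count₁≡ refl)) (subst (λ c → count c (e i) ≡ 1) a≡1 (count-self i)))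

  digit≢0 : ∀ i → digit (e i) ≢ 0
  digit≢0 i d≡0 with occupied i
  ... | inj₁ (_ , half≡1) = contradiction (trans (cong (_/ 2) (sym d≡0)) half≡1) λ ()
  ... | inj₂ (_ , odd)    = contradiction (trans (cong (_% 2) (sym d≡0)) odd) λ ()

  digit≡2⇒a≡0 : ∀ i → digit (e i) ≡ 2 → a i ≡ 0
  digit≡2⇒a≡0 i d≡2 with occupied i
  ... | inj₁ (a≡0 , _) = a≡0
  ... | inj₂ (_ , odd) = contradiction (trans (cong (_% 2) (sym d≡2)) odd) λ ()

  digit≡1⇒a≡1 : ∀ i → digit (e i) ≡ 1 → a i ≡ 1
  digit≡1⇒a≡1 i d≡1 with occupied i
  ... | inj₁ (_ , half≡1) = contradiction (trans (cong (_/ 2) (sym d≡1)) half≡1) λ ()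
  ... | inj₂ (a≡1 , _)    = a≡1

  B∸m≡7 : B ∸ m ≡ 7
  B∸m≡7 = trans (cong (_∸ m) B≡m+7) (m+n∸m≡n m 7)

  x-at : ∀ i {c k} → a i ≡ c → e i ≡ k → x i ≡ 2 ^ c * 3 ^ (B ∸ k)
  x-at i refl refl = x≡2^a*3^[B∸e] i

  x∈sol : ∀ i → ∃[ j ] sol j ≡ x i
  x∈sol i with <-cmp (e i) m
  ... | tri< e<m _ _ = contradiction (zeros (e i) e<m) (digit≢0 i)
  ... | tri≈ _ e≡m _ with ≤1⇒≡0⊎≡1 (a≤1 i)
  ...   | inj₁ a≡0 = 7F , sym (trans (x-at i a≡0 e≡m) (cong (λ r → 2 ^ 0 * 3 ^ r) B∸m≡7))
  ...   | inj₂ a≡1 = 8F , sym (trans (x-at i a≡1 e≡m) (cong (λ r → 2 ^ 1 * 3 ^ r) B∸m≡7))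
  x∈sol i | tri> _ _ m<e with <-cmp (e i) B
  ... | tri< e<B _ _ =
    let j , sol≡ = sol-3^ (B ∸ e i) (m<n⇒0<n∸m e<B) (subst (B ∸ e i ≤_) B∸1+m≡6 (∸-monoʳ-≤ B m<e))
    in j , trans sol≡ (sym (x-at i (digit≡2⇒a≡0 i (twos (e i) e<B m<e)) refl))
  ... | tri≈ _ e≡B _ = 0F , sym (trans (x-at i (digit≡1⇒a≡1 i (subst (λ k → digit k ≡ 1) (sym e≡B) top)) e≡B)
                                       (cong (λ r → 2 ^ 1 * 3 ^ r) (n∸n≡0 B)))
  ... | tri> _ _ B<e = contradiction (e≤B i) (<⇒≱ B<e)

  occupant : ∀ c k → count c k ≡ 1 → ∃[ i ] x i ≡ 2 ^ c * 3 ^ (B ∸ k)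
  occupant c k count≡1 =
    let i , 0<term = sum-pos (λ i → 𝟙 (e i ≟ k) * 𝟙 (a i ≟ c)) (subst (0 <_) (sym count≡1) (s≤s z≤n))
        e≡k , a≡c  = 𝟙*𝟙-pos (e i ≟ k) (a i ≟ c) 0<term
    in i , x-at i a≡c e≡k

  middle-occupant : (d : Fin 6) → ∃[ i ] x i ≡ 2 ^ 0 * 3 ^ (6 ∸ toℕ d)
  middle-occupant d =
    let i , x≡ = occupant 0 k (count₀≡ (twos k k<B m<k′)) in i , trans x≡ (cong (λ r → 2 ^ 0 * 3 ^ r) B∸k≡)
    where
    k : ℕ
    k = m + suc (toℕ d)
    m<k′ : m < k
    m<k′ = m<m+n m z<s
    k<B : k < B
    k<B = subst (k <_) (sym B≡m+7) (+-monoʳ-< m (s<s (Fin.toℕ<n d)))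
    B∸k≡ : B ∸ k ≡ 6 ∸ toℕ d
    B∸k≡ = trans (cong (_∸ k) B≡m+7) ([m+n]∸[m+o]≡n∸o m 7 (suc (toℕ d)))

  sol∈x : ∀ j → ∃[ i ] x i ≡ sol j
  sol∈x 0F = let i , x≡ = occupant 1 B (count₁≡ top) in i , trans x≡ (cong (λ r → 2 ^ 1 * 3 ^ r) (n∸n≡0 B))
  sol∈x 1F = middle-occupant 5F
  sol∈x 2F = middle-occupant 4F
  sol∈x 3F = middle-occupant 3F
  sol∈x 4F = middle-occupant 2F
  sol∈x 5F = middle-occupant 1F
  sol∈x 6F = middle-occupant 0F
  sol∈x 7F = let i , x≡ = occupant 0 m (count₀≡ three) in i , trans x≡ (cong (λ r → 2 ^ 0 * 3 ^ r) B∸m≡7)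
  sol∈x 8F = let i , x≡ = occupant 1 m (count₁≡ three) in i , trans x≡ (cong (λ r → 2 ^ 1 * 3 ^ r) B∸m≡7)

  same-elements : ∀ n → (∃[ i ] x i ≡ n) ⇔ (∃[ j ] sol j ≡ n)
  same-elements n = mk⇔ (λ { (i , refl) → x∈sol i }) (λ { (j , refl) → sol∈x j })

  has-2 : Has2 x
  has-2 = sol∈x 0F

classify : ∀ x → IsSolution x → α₂ x ≡ 1 → Has2 x × (∀ n → (∃[ i ] x i ≡ n) ⇔ (∃[ j ] sol j ≡ n))
classify x (x-injective , x>0 , ∑1/x≡1 , _ , p , p-prime , p≢2 , prime-divisors) α₂≡1 =
  has-2 , same-elements
  where open Classification x x-injective x>0 ∑1/x≡1 p p-prime p≢2 prime-divisors α₂≡1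

lemma3 : ((x : Fin 9 → ℕ) → IsSolution x → ¬ Has2 x → ¬ (α₂ x ≡ 1))
         × ((x : Fin 9 → ℕ) → IsSolution x → Has2 x → α₂ x ≡ 1 →
              ∀ n → ((∃[ i ] x i ≡ n) ⇔ (∃[ j ] sol j ≡ n)))
         × (IsSolution sol × Has2 sol × α₂ sol ≡ 1)
lemma3 = (λ x x-sol 2∉x α₂≡1 → 2∉x (proj₁ (classify x x-sol α₂≡1)))
       , (λ x x-sol _ α₂≡1 → proj₂ (classify x x-sol α₂≡1))
       , sol-isSolution , (0F , refl) , refl
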